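{- There are infinitely many primitive Pythagorean triples $(x,y,z)$ such that exactly one of the three components $x,y,z$ is a numeric palindrome.
   Context: A Pythagorean triple is a triple $(x,y,z)$ of positive integers with $x^2+y^2=z^2$; it is primitive if $\gcd(x,y,z)=1$. A numeric palindrome is a positive integer whose decimal representation (without leading zeros) reads the same forwards and backwards. -}

module Defs where

open import Data.Nat using (ℕ; zero; suc; _+_; _*_; _<_; _/_; _%_)
open import Data.Nat.GCD using (gcd)
open import Data.List using (List; []; _∷_; reverse)
open import Data.Product using (_×_)
open import Data.Sum using (_⊎_)
open import Relation.Binary.PropositionalEquality using (_≡_)
open import Relation.Nullary using (¬_)

-- decimal digits, least significant first; fuel argument guarantees termination
digitsAux : ℕ → ℕ → List ℕ
digitsAux zero    _       = []
digitsAux (suc f) zero    = []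
digitsAux (suc f) (suc m) = (suc m % 10) ∷ digitsAux f (suc m / 10)

-- decimal representation without leading zeros (empty for 0);
-- fuel n suffices since n has at most n decimal digits
decDigits : ℕ → List ℕ
decDigits n = digitsAux n n

IsPalindrome : ℕ → Set
IsPalindrome n = (0 < n) × (reverse (decDigits n) ≡ decDigits n)

IsPythTriple : ℕ → ℕ → ℕ → Set
IsPythTriple x y z = (0 < x) × (0 < y) × (0 < z) × (x * x + y * y ≡ z * z)

IsPrimitive : ℕ → ℕ → ℕ → Set
IsPrimitive x y z = gcd (gcd x y) z ≡ 1

ExactlyOnePalindrome : ℕ → ℕ → ℕ → Set
ExactlyOnePalindrome x y z =
    (IsPalindrome x × ¬ IsPalindrome y × ¬ IsPalindrome z)
  ⊎ (¬ IsPalindrome x × IsPalindrome y × ¬ IsPalindrome z)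
  ⊎ (¬ IsPalindrome x × ¬ IsPalindrome y × IsPalindrome z)

module Submission where

-- The triples come from the classical odd-leg family
--   (x, y, z) = (2u + 1, 2u(u + 1), 2u(u + 1) + 1),
-- i.e. x odd, y = (x² − 1)/2, z = y + 1; every member is a Pythagorean
-- triple, and it is primitive because y and z are consecutive.
-- Choosing u = 5·10^k with k ≥ 1 gives, in decimal,
--   x = 1 0…0 1                    (a palindrome),
--   y = 5·10^(2k+1) + 10^(k+1)     (leading digit 5, last digit 0),
--   z = 5·10^(2k+1) + 10^(k+1) + 1 (leading digit 5, last digit 1),
-- so exactly one component, x, is a palindrome; k = N + 1 makes z > N.

open import Defs
open import Data.Nat using (ℕ; zero; suc; _+_; _*_; _^_; _<_; _≤_; _/_; _%_; z≤n; s≤s; NonZero)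
open import Data.Nat.Properties
open import Data.Nat.DivMod
open import Data.Nat.Divisibility using (_∣_; divides-refl; ∣-trans; ∣m+n∣m⇒∣n; ∣1⇒≡1)
open import Data.Nat.GCD using (gcd; gcd[m,n]∣m; gcd[m,n]∣n)
open import Data.Nat.Tactic.RingSolver using (solve-∀)
open import Data.List using (List; []; _∷_; reverse; replicate; _∷ʳ_)
open import Data.List.Properties using (reverse-++; unfold-reverse; ∷-injectiveˡ)
open import Data.Product using (Σ; _×_; _,_; proj₁; proj₂)
open import Data.Sum using (inj₁)
open import Relation.Binary.PropositionalEquality
open import Relation.Nullary using (¬_)

digitsAux-fuel : ∀ f g n → n ≤ f → n ≤ g → digitsAux f n ≡ digitsAux g n
digitsAux-fuel zero    zero    zero    _       _       = refl
digitsAux-fuel zero    (suc g) zero    _       _       = refl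
digitsAux-fuel (suc f) zero    zero    _       _       = refl
digitsAux-fuel (suc f) (suc g) zero    _       _       = refl
digitsAux-fuel (suc f) (suc g) (suc n) (s≤s n≤f) (s≤s n≤g) =
  cong (suc n % 10 ∷_) (digitsAux-fuel f g (suc n / 10) (≤-trans q≤n n≤f) (≤-trans q≤n n≤g))
  where
  q≤n : suc n / 10 ≤ n
  q≤n = ≤-pred (m/n<m (suc n) 10 (s≤s (s≤s z≤n)))

decDigits-pos : ∀ n → 0 < n → decDigits n ≡ n % 10 ∷ decDigits (n / 10)
decDigits-pos (suc m) _ =
  cong (suc m % 10 ∷_) (digitsAux-fuel m (suc m / 10) (suc m / 10) q≤m ≤-refl)
  where
  q≤m : suc m / 10 ≤ m
  q≤m = ≤-pred (m/n<m (suc m) 10 (s≤s (s≤s z≤n)))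

decDigits-step : ∀ d q → d < 10 → 0 < q → decDigits (d + q * 10) ≡ d ∷ decDigits q
decDigits-step d q d<10 q>0 = begin
  decDigits (d + q * 10)
    ≡⟨ decDigits-pos (d + q * 10) (≤-trans q>0 (≤-trans (m≤m*n q 10) (m≤n+m (q * 10) d))) ⟩
  (d + q * 10) % 10 ∷ decDigits ((d + q * 10) / 10)
    ≡⟨ cong₂ (λ r s → r ∷ decDigits s) lastDigit quotient ⟩
  d ∷ decDigits q ∎
  where
  open ≡-Reasoning
  lastDigit : (d + q * 10) % 10 ≡ d
  lastDigit = trans ([m+kn]%n≡m%n d q 10) (m<n⇒m%n≡m d<10)
  quotient : (d + q * 10) / 10 ≡ q
  quotient = trans (+-distrib-/-∣ʳ d (divides-refl q))
                   (cong₂ _+_ (m<n⇒m/n≡0 d<10) (m*n/n≡m q 10))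

decDigits-digit : ∀ a → 0 < a → a < 10 → decDigits a ≡ a ∷ []
decDigits-digit a a>0 a<10 = trans (decDigits-pos a a>0)
  (cong₂ (λ r s → r ∷ decDigits s) (m<n⇒m%n≡m a<10) (m<n⇒m/n≡0 a<10))

decDigits-10^ : ∀ k → decDigits (10 ^ k) ≡ replicate k 0 ∷ʳ 1
decDigits-10^ zero    = refl
decDigits-10^ (suc k) = begin
  decDigits (10 * 10 ^ k) ≡⟨ cong decDigits (*-comm 10 (10 ^ k)) ⟩
  decDigits (0 + 10 ^ k * 10) ≡⟨ decDigits-step 0 (10 ^ k) (s≤s z≤n) (m^n>0 10 k) ⟩
  0 ∷ decDigits (10 ^ k) ≡⟨ cong (0 ∷_) (decDigits-10^ k) ⟩
  0 ∷ (replicate k 0 ∷ʳ 1) ∎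
  where open ≡-Reasoning

lowDigitSplit : ∀ j r a → r + 10 ^ suc j * a ≡ r % 10 + (r / 10 + 10 ^ j * a) * 10
lowDigitSplit j r a = begin
  r + 10 ^ suc j * a
    ≡⟨ cong (_+ 10 ^ suc j * a) (m≡m%n+[m/n]*n r 10) ⟩
  r % 10 + r / 10 * 10 + 10 * 10 ^ j * a
    ≡⟨ regroup (r % 10) (r / 10) (10 ^ j) a ⟩
  r % 10 + (r / 10 + 10 ^ j * a) * 10 ∎
  where
  open ≡-Reasoning
  regroup : ∀ d q p a → d + q * 10 + 10 * p * a ≡ d + (q + p * a) * 10
  regroup = solve-∀

mutual
  leadingDigit : ∀ j r a → r < 10 ^ j → 0 < a → a < 10 →
                 Σ (List ℕ) λ ys → decDigits (r + 10 ^ j * a) ≡ ys ∷ʳ a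
  leadingDigit zero    zero    a _         a>0 a<10 =
    [] , trans (cong decDigits (*-identityˡ a)) (decDigits-digit a a>0 a<10)
  leadingDigit zero    (suc r) a (s≤s ()) _ _
  leadingDigit (suc j) r       a r<10^j+1  a>0 a<10 with lastAndLeadingDigit j r a r<10^j+1 a>0 a<10
  ... | ys , digits = r % 10 ∷ ys , digits

  lastAndLeadingDigit : ∀ j r a → r < 10 ^ suc j → 0 < a → a < 10 →
                        Σ (List ℕ) λ ys → decDigits (r + 10 ^ suc j * a) ≡ r % 10 ∷ (ys ∷ʳ a)
  lastAndLeadingDigit j r a r<10^j+1 a>0 a<10 = lowDigitFirst (leadingDigit j (r / 10) a r/10<10^j a>0 a<10)
    where
    r/10<10^j : r / 10 < 10 ^ j
    r/10<10^j = m<n*o⇒m/o<n (subst (r <_) (*-comm 10 (10 ^ j)) r<10^j+1)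
    q>0 : 0 < r / 10 + 10 ^ j * a
    q>0 = ≤-trans (*-mono-≤ (m^n>0 10 j) a>0) (m≤n+m (10 ^ j * a) (r / 10))
    lowDigitFirst : Σ (List ℕ) (λ ys → decDigits (r / 10 + 10 ^ j * a) ≡ ys ∷ʳ a) →
                    Σ (List ℕ) λ ys → decDigits (r + 10 ^ suc j * a) ≡ r % 10 ∷ (ys ∷ʳ a)
    lowDigitFirst (ys , digits) = ys , (begin
      decDigits (r + 10 ^ suc j * a)
        ≡⟨ cong decDigits (lowDigitSplit j r a) ⟩
      decDigits (r % 10 + (r / 10 + 10 ^ j * a) * 10)
        ≡⟨ decDigits-step (r % 10) (r / 10 + 10 ^ j * a) (m%n<n r 10) q>0 ⟩
      r % 10 ∷ decDigits (r / 10 + 10 ^ j * a)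
        ≡⟨ cong (r % 10 ∷_) digits ⟩
      r % 10 ∷ (ys ∷ʳ a) ∎)
      where open ≡-Reasoning

reverse-framed : ∀ {A : Set} (a b : A) xs → reverse (a ∷ (xs ∷ʳ b)) ≡ b ∷ (reverse xs ∷ʳ a)
reverse-framed a b xs = trans (unfold-reverse a (xs ∷ʳ b)) (cong (_∷ʳ a) (reverse-++ xs (b ∷ [])))

reverse-replicate : ∀ {A : Set} k (a : A) → reverse (replicate k a) ≡ replicate k a
reverse-replicate zero    a = refl
reverse-replicate (suc k) a = begin
  reverse (a ∷ replicate k a) ≡⟨ unfold-reverse a (replicate k a) ⟩
  reverse (replicate k a) ∷ʳ a ≡⟨ cong (_∷ʳ a) (reverse-replicate k a) ⟩
  replicate k a ∷ʳ a ≡⟨ replicate-∷ʳ k ⟩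
  a ∷ replicate k a ∎
  where
  open ≡-Reasoning
  replicate-∷ʳ : ∀ k → replicate k a ∷ʳ a ≡ a ∷ replicate k a
  replicate-∷ʳ zero    = refl
  replicate-∷ʳ (suc k) = cong (a ∷_) (replicate-∷ʳ k)

differentEnds⇒¬palindrome : ∀ n d a ys → decDigits n ≡ d ∷ (ys ∷ʳ a) → ¬ d ≡ a → ¬ IsPalindrome n
differentEnds⇒¬palindrome n d a ys digits d≢a (_ , palindrome) = d≢a (sym (∷-injectiveˡ reversed))
  where
  reversed : a ∷ (reverse ys ∷ʳ d) ≡ d ∷ (ys ∷ʳ a)
  reversed = begin
    a ∷ (reverse ys ∷ʳ d)   ≡⟨ reverse-framed d a ys ⟨
    reverse (d ∷ (ys ∷ʳ a)) ≡⟨ cong reverse digits ⟨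
    reverse (decDigits n)   ≡⟨ palindrome ⟩
    decDigits n             ≡⟨ digits ⟩
    d ∷ (ys ∷ʳ a)           ∎
    where open ≡-Reasoning

¬palindrome-r+10^[1+j]*a : ∀ j r a → r < 10 ^ suc j → 0 < a → a < 10 → ¬ r % 10 ≡ a →
                           ¬ IsPalindrome (r + 10 ^ suc j * a)
¬palindrome-r+10^[1+j]*a j r a r<10^j+1 a>0 a<10 r%10≢a =
  differentEnds⇒¬palindrome (r + 10 ^ suc j * a) (r % 10) a (proj₁ digits) (proj₂ digits) r%10≢a
  where
  digits : Σ (List ℕ) λ ys → decDigits (r + 10 ^ suc j * a) ≡ r % 10 ∷ (ys ∷ʳ a)
  digits = lastAndLeadingDigit j r a r<10^j+1 a>0 a<10

1+10^k*10-palindrome : ∀ k → IsPalindrome (1 + 10 ^ k * 10)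
1+10^k*10-palindrome k = s≤s z≤n , (begin
  reverse (decDigits (1 + 10 ^ k * 10))   ≡⟨ cong reverse digits ⟩
  reverse (1 ∷ (replicate k 0 ∷ʳ 1))     ≡⟨ reverse-framed 1 1 (replicate k 0) ⟩
  1 ∷ (reverse (replicate k 0) ∷ʳ 1)     ≡⟨ cong (λ zs → 1 ∷ (zs ∷ʳ 1)) (reverse-replicate k 0) ⟩
  1 ∷ (replicate k 0 ∷ʳ 1)               ≡⟨ digits ⟨
  decDigits (1 + 10 ^ k * 10)            ∎)
  where
  open ≡-Reasoning
  digits : decDigits (1 + 10 ^ k * 10) ≡ 1 ∷ (replicate k 0 ∷ʳ 1)
  digits = trans (decDigits-step 1 (10 ^ k) (s≤s (s≤s z≤n)) (m^n>0 10 k))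
                 (cong (1 ∷_) (decDigits-10^ k))

oddLeg : ℕ → ℕ
oddLeg u = 1 + 2 * u

evenLeg : ℕ → ℕ
evenLeg u = 2 * u * suc u

oddLegTriple : ∀ u → 0 < u → IsPythTriple (oddLeg u) (evenLeg u) (suc (evenLeg u))
oddLegTriple u u>0 = s≤s z≤n , *-mono-≤ (≤-trans (s≤s z≤n) (*-monoʳ-≤ 2 u>0)) (s≤s z≤n) , s≤s z≤n , identity u
  where
  identity : ∀ u → (1 + 2 * u) * (1 + 2 * u) + 2 * u * suc u * (2 * u * suc u)
                   ≡ suc (2 * u * suc u) * suc (2 * u * suc u)
  identity = solve-∀

consecutive⇒primitive : ∀ x y → IsPrimitive x y (suc y)
consecutive⇒primitive x y = ∣1⇒≡1 (∣m+n∣m⇒∣n g∣y+1 g∣y)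
  where
  g : ℕ
  g = gcd (gcd x y) (suc y)
  g∣y : g ∣ y
  g∣y = ∣-trans (gcd[m,n]∣m (gcd x y) (suc y)) (gcd[m,n]∣n x y)
  g∣y+1 : g ∣ y + 1
  g∣y+1 = subst (g ∣_) (+-comm 1 y) (gcd[m,n]∣n (gcd x y) (suc y))

n<m^n : ∀ m .{{_ : NonZero m}} → 1 < m → ∀ n → n < m ^ n
n<m^n m 1<m zero    = m^n>0 m 0
n<m^n m 1<m (suc n) = ≤-<-trans (n<m^n m 1<m n) (^-monoʳ-< m 1<m (n<1+n n))

1+10^m<10^[1+m] : ∀ m → 1 + 10 ^ m < 10 ^ suc m
1+10^m<10^[1+m] m = begin-strict
  1 + 10 ^ m     ≡⟨ +-comm 1 (10 ^ m) ⟩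
  10 ^ m + 1     <⟨ +-monoʳ-< (10 ^ m) (≤-trans (s≤s (s≤s z≤n)) (m≤m*n 9 (10 ^ m) {{m^n≢0 10 m}})) ⟩
  10 ^ m + 9 * 10 ^ m ≡⟨⟩
  10 ^ suc m     ∎
  where open ≤-Reasoning

oddLeg-decimal : ∀ k → oddLeg (5 * 10 ^ k) ≡ 1 + 10 ^ k * 10
oddLeg-decimal k = cong suc (twoU (10 ^ k))
  where
  twoU : ∀ t → 2 * (5 * t) ≡ t * 10
  twoU = solve-∀

evenLeg-decimal : ∀ k → evenLeg (5 * 10 ^ k) ≡ 10 ^ k * 10 + 10 ^ suc (k + k) * 5
evenLeg-decimal k = begin
  2 * (5 * t) * suc (5 * t)      ≡⟨ expand t ⟩
  t * 10 + 10 * (t * t) * 5      ≡⟨ cong (λ p → t * 10 + 10 * p * 5) (^-distribˡ-+-* 10 k k) ⟨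
  t * 10 + 10 ^ suc (k + k) * 5  ∎
  where
  open ≡-Reasoning
  t : ℕ
  t = 10 ^ k
  expand : ∀ t → 2 * (5 * t) * suc (5 * t) ≡ t * 10 + 10 * (t * t) * 5
  expand = solve-∀

-- For k ≥ 1 the low part 10^(k+1) + 1 stays below 10^(2k+1), so the leading
-- digit of y and of z = y + 1 is 5.
lowPart< : ∀ k → 0 < k → 1 + 10 ^ k * 10 < 10 ^ suc (k + k)
lowPart< k@(suc m) _ = begin-strict
  1 + 10 ^ k * 10     ≡⟨ cong suc (*-comm (10 ^ k) 10) ⟩
  1 + 10 ^ suc k      <⟨ 1+10^m<10^[1+m] (suc k) ⟩
  10 ^ suc (suc k)    ≤⟨ ^-monoʳ-≤ 10 (s≤s (s≤s (m≤n+m k m))) ⟩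
  10 ^ suc (k + k)    ∎
  where open ≤-Reasoning

oddLeg-palindrome : ∀ k → IsPalindrome (oddLeg (5 * 10 ^ k))
oddLeg-palindrome k = subst IsPalindrome (sym (oddLeg-decimal k)) (1+10^k*10-palindrome k)

0<5 : 0 < 5
0<5 = s≤s z≤n

5<10 : 5 < 10
5<10 = s≤s (s≤s (s≤s (s≤s (s≤s (s≤s z≤n)))))

-- y ends in 0 but starts with 5.
evenLeg-¬palindrome : ∀ k → 0 < k → ¬ IsPalindrome (evenLeg (5 * 10 ^ k))
evenLeg-¬palindrome k k>0 = subst (λ n → ¬ IsPalindrome n) (sym (evenLeg-decimal k))
  (¬palindrome-r+10^[1+j]*a (k + k) (10 ^ k * 10) 5 (<-trans (n<1+n _) (lowPart< k k>0)) 0<5 5<10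
     (λ last≡5 → 0≢1+n (trans (sym (m*n%n≡0 (10 ^ k) 10)) last≡5)))

-- z = y + 1 ends in 1 but starts with 5.
hypotenuse-¬palindrome : ∀ k → 0 < k → ¬ IsPalindrome (suc (evenLeg (5 * 10 ^ k)))
hypotenuse-¬palindrome k k>0 = subst (λ n → ¬ IsPalindrome n) (sym (cong suc (evenLeg-decimal k)))
  (¬palindrome-r+10^[1+j]*a (k + k) (1 + 10 ^ k * 10) 5 (lowPart< k k>0) 0<5 5<10
     (λ last≡5 → 0≢1+n (suc-injective (trans (sym ([m+kn]%n≡m%n 1 (10 ^ k) 10)) last≡5))))

k<evenLeg : ∀ k → k < evenLeg (5 * 10 ^ k)
k<evenLeg k = begin-strict
  k                          <⟨ n<m^n 10 (s≤s (s≤s z≤n)) k ⟩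
  10 ^ k                     ≤⟨ m≤n*m (10 ^ k) 5 ⟩
  u                          ≤⟨ m≤n*m u 2 ⟩
  2 * u                      ≤⟨ m≤m*n (2 * u) (suc u) ⟩
  evenLeg u                  ∎
  where
  open ≤-Reasoning
  u : ℕ
  u = 5 * 10 ^ k

theorem3p5 : (N : ℕ) → Σ ℕ λ x → Σ ℕ λ y → Σ ℕ λ z →
    N < z × IsPythTriple x y z × IsPrimitive x y z × ExactlyOnePalindrome x y z
theorem3p5 N =
  oddLeg u , evenLeg u , suc (evenLeg u) ,
  <-trans (n<1+n N) (m<n⇒m<1+n (k<evenLeg k)) ,
  oddLegTriple u (≤-trans 0<5 (*-monoʳ-≤ 5 (m^n>0 10 k))) ,
  consecutive⇒primitive (oddLeg u) (evenLeg u) ,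
  inj₁ (oddLeg-palindrome k , evenLeg-¬palindrome k k>0 , hypotenuse-¬palindrome k k>0)
  where
  k u : ℕ
  k = suc N
  u = 5 * 10 ^ k
  k>0 : 0 < k
  k>0 = s≤s z≤n
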